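{- Let $d\ge 2$ and let $\mathbf{n}=(n_1,\dots,n_d)$ be a $d$-dimensional shape. Then, for any dimer configuration $D$ on $\mathbb{Q}_\mathbf{n}^d$, there exists $\mathbf{x}\in\mathbb{Z}^d$ such that the unit cube $\mathbf{x}+\mathbb{Q}^d\subseteq\mathbb{Q}_\mathbf{n}^d$ contains at least $2^{d-2}+1$ dimers of $D$ (i.e. at least $2^{d-2}+1$ dimers of $D$ have both endpoints in $\mathbf{x}+\mathbb{Q}^d$).
   Context: A dimer configuration on a graph $G$ is a perfect matching of $G$; its edges are called dimers. For a positive integer $n$, $[n]=\{1,\dots,n\}$. A $d$-dimensional shape is a vector $\mathbf{n}=(n_1,\dots,n_d)$ of integers with $n_1,\dots,n_d\ge 2$ and $n_1\cdots n_d$ even. The box $\mathbb{Q}^d_\mathbf{n}$ is the graph with vertex set $\prod_{i=1}^d[n_i]$, where $\mathbf{u},\mathbf{v}$ are adjacent if there is $i\in[d]$ with $u_j=v_j$ for all $j\ne i$ and $|u_i-v_i|=1$. $\mathbb{Q}^d$ denotes $\mathbb{Q}^d_{(2,\dots,2)}$, the unit hypercube with vertex set $[2]^d$, and $\mathbf{x}+\mathbb{Q}^d$ is its translate by $\mathbf{x}$ (as an induced subgraph of $\mathbb{Q}^d_\mathbf{n}$). -}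

module Defs where

open import Data.Nat using (ℕ; suc; _≤_; _<_; _*_; _≟_; _≤?_; _<?_)
open import Data.Nat.Divisibility using (_∣_)
open import Data.Fin using (Fin; _≟_)
open import Data.Fin.Properties using (all?)
open import Data.Vec using (Vec; lookup; foldr)
import Data.Vec.Properties as VP
open import Data.List using (List; filter; length)
open import Data.Product using (Σ; ∃; _×_; _,_; proj₁; proj₂)
open import Data.Sum using (_⊎_)
open import Relation.Nullary using (¬_; Dec)
open import Relation.Nullary.Decidable using (_×-dec_; _⊎-dec_)
open import Relation.Binary.PropositionalEquality using (_≡_)

-- Vertices of the lattice are integer vectors of length d; we use
-- 0-based coordinates: the box Q^d_n has vertex set ∏ {0,…,n_i - 1}
-- (a translate of ∏ [n_i]).
Point : ℕ → Set
Point d = Vec ℕ d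

vprod : ∀ {d} → Vec ℕ d → ℕ
vprod = foldr _ _*_ 1

IsShape : ∀ {d} → Vec ℕ d → Set
IsShape {d} n = (∀ (i : Fin d) → 2 ≤ lookup n i) × (2 ∣ vprod n)

InBox : ∀ {d} → Vec ℕ d → Point d → Set
InBox {d} n u = ∀ (i : Fin d) → lookup u i < lookup n i

Adjacent : ∀ {d} → Point d → Point d → Set
Adjacent {d} u v = Σ (Fin d) λ i →
  (∀ (j : Fin d) → ¬ (j ≡ i) → lookup u j ≡ lookup v j) ×
  ((suc (lookup u i) ≡ lookup v i) ⊎ (suc (lookup v i) ≡ lookup u i))

IsEdge : ∀ {d} → Vec ℕ d → Point d × Point d → Set
IsEdge n (u , v) = InBox n u × InBox n v × Adjacent u v

_∈ₑ_ : ∀ {d} → Point d → Point d × Point d → Set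
v ∈ₑ (a , b) = (v ≡ a) ⊎ (v ≡ b)

_∈ₑ?_ : ∀ {d} (v : Point d) (e : Point d × Point d) → Dec (v ∈ₑ e)
v ∈ₑ? (a , b) = VP.≡-dec Data.Nat._≟_ v a ⊎-dec VP.≡-dec Data.Nat._≟_ v b

-- A dimer configuration (perfect matching) on Q^d_n, given as the list of
-- its dimers (each edge listed once, as an ordered pair of its endpoints):
-- every listed pair is an edge of the box, and every vertex of the box
-- lies in exactly one listed dimer.  (Exactly-one also excludes repeated
-- entries, including a reversed copy of an edge.)
IsDimerConfig : ∀ {d} → Vec ℕ d → List (Point d × Point d) → Set
IsDimerConfig {d} n D =
  (∀ e → e Data.List.Membership.Propositional.∈ D → IsEdge n e) ×
  (∀ (v : Point d) → InBox n v → length (filter (v ∈ₑ?_) D) ≡ 1)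
  where import Data.List.Membership.Propositional

InCube : ∀ {d} → Point d → Point d → Set
InCube {d} x u = ∀ (i : Fin d) → (lookup x i ≤ lookup u i) × (lookup u i ≤ suc (lookup x i))

InCube? : ∀ {d} (x u : Point d) → Dec (InCube x u)
InCube? x u = all? (λ i → (lookup x i ≤? lookup u i) ×-dec (lookup u i ≤? suc (lookup x i)))

-- the unit cube x + Q^d is contained in the box Q^d_n: x_i + 1 < n_i
-- (lower corner x_i ≥ 0 is automatic since x ∈ ℕ^d)
CubeInBox : ∀ {d} → Vec ℕ d → Point d → Set
CubeInBox {d} n x = ∀ (i : Fin d) → suc (suc (lookup x i)) ≤ lookup n i

DimerInCube : ∀ {d} → Point d → Point d × Point d → Set
DimerInCube x (a , b) = InCube x a × InCube x b

DimerInCube? : ∀ {d} (x : Point d) (e : Point d × Point d) → Dec (DimerInCube x e)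
DimerInCube? x (a , b) = InCube? x a ×-dec InCube? x b

dimersInCube : ∀ {d} → Point d → List (Point d × Point d) → ℕ
dimersInCube x D = length (filter (DimerInCube? x) D)

-- Suppose every unit cube of the box contains at most 2^(d-2) dimers, and double count
-- pairs (cube, vertex in it) and pairs (cube, dimer in it). A vertex v lies in cv(v) =
-- ∏ⱼ aⱼ(v) cubes, with aⱼ(v) ≤ 2 the number of cube positions in direction j covering vⱼ;
-- a dimer uv in direction i lies in ∏ⱼ bⱼ cubes, where bⱼ = aⱼ(u) = aⱼ(v) for j ≠ i and
-- bᵢ ≥ 1. Hence cv(u) + cv(v) ≤ 4 · #(cubes containing uv), and strictly so for the dimer
-- covering the corner 0, since aᵢ(0) = 1. Summing over the perfect matching,
-- 2^d · #cubes ≤ Σ_v cv(v) ≤ Σ_uv (cv(u) + cv(v)) < 4 · Σ_cubes #dimers ≤ 2^d · #cubes,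
-- a contradiction.
{-# OPTIONS --safe #-}
module Submission where

open import Defs
open import Data.Empty using (⊥-elim)
open import Data.Fin using (Fin; zero; suc; punchIn)
import Data.Fin as Fin
open import Data.Fin.Properties using (all?; punchInᵢ≢i)
open import Data.List using (List; []; _∷_; _++_; map; filter; length; downFrom; cartesianProductWith)
open import Data.List.Membership.Propositional using (_∈_; find)
open import Data.List.Membership.Propositional.Properties using (∈-filter⁺; ∈-downFrom⁺; ∈-downFrom⁻)
open import Data.List.Properties using (length-++; filter-++; filter-none; filter-≐; filter-accept)
open import Data.List.Relation.Unary.All as All using (All; []; _∷_)
open import Data.List.Relation.Unary.All.Properties using (¬Any⇒All¬; cartesianProductWith⁺)
open import Data.List.Relation.Unary.Any using (here; there; any?)
open import Data.Nat using (ℕ; zero; suc; pred; _+_; _*_; _^_; _∸_; _≤_; _<_; z≤n; s≤s; _≟_; _≤?_; _<?_)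
open import Data.Nat.Properties
open import Algebra.Properties.CommutativeSemigroup +-commutativeSemigroup using (interchange)
open import Algebra.Properties.CommutativeSemigroup *-commutativeSemigroup using (x∙yz≈y∙xz)
open import Data.Product using (Σ; _×_; _,_; proj₁; proj₂)
open import Data.Sum using (_⊎_; inj₁; inj₂; [_,_])
open import Data.Vec using (Vec; []; _∷_; lookup; replicate)
import Data.Vec.Properties as Vec
open import Function using (_∘_)
open import Relation.Binary.PropositionalEquality
  using (_≡_; _≢_; refl; sym; trans; cong; cong₂; subst; setoid; module ≡-Reasoning)
open import Relation.Nullary using (¬_; Dec; yes; no)
open import Relation.Nullary.Decidable using (_×-dec_)
open import Relation.Unary using (Decidable; _⊆_; ∁)

private
  variable
    A B : Set

count : ∀ {P : A → Set} → Decidable P → List A → ℕ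
count P? xs = length (filter P? xs)

indicator : ∀ {P : Set} → Dec P → ℕ
indicator (yes _) = 1
indicator (no _)  = 0

∑ : List A → (A → ℕ) → ℕ
∑ []       f = 0
∑ (x ∷ xs) f = f x + ∑ xs f

∑-+ : ∀ xs (f g : A → ℕ) → ∑ xs (λ x → f x + g x) ≡ ∑ xs f + ∑ xs g
∑-+ []       f g = refl
∑-+ (x ∷ xs) f g = trans (cong (f x + g x +_) (∑-+ xs f g)) (interchange (f x) (g x) (∑ xs f) (∑ xs g))

∑-*ˡ : ∀ xs c (f : A → ℕ) → ∑ xs (λ x → c * f x) ≡ c * ∑ xs f
∑-*ˡ []       c f = sym (*-zeroʳ c)
∑-*ˡ (x ∷ xs) c f = trans (cong (c * f x +_) (∑-*ˡ xs c f)) (sym (*-distribˡ-+ c (f x) (∑ xs f)))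

∑-zero : ∀ xs → ∑ xs (λ (_ : A) → 0) ≡ 0
∑-zero []       = refl
∑-zero (x ∷ xs) = ∑-zero xs

∑-cong : ∀ {f g : A → ℕ} {xs} → All (λ x → f x ≡ g x) xs → ∑ xs f ≡ ∑ xs g
∑-cong []         = refl
∑-cong (eq ∷ eqs) = cong₂ _+_ eq (∑-cong eqs)

∑-mono-≤ : ∀ {f g : A → ℕ} {xs} → All (λ x → f x ≤ g x) xs → ∑ xs f ≤ ∑ xs g
∑-mono-≤ []         = z≤n
∑-mono-≤ (le ∷ les) = +-mono-≤ le (∑-mono-≤ les)

∑-swap : ∀ xs (ys : List B) (f : A → B → ℕ) →
         ∑ xs (λ x → ∑ ys (f x)) ≡ ∑ ys (λ y → ∑ xs (λ x → f x y))
∑-swap []       ys f = sym (∑-zero ys)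
∑-swap (x ∷ xs) ys f =
  trans (cong (∑ ys (f x) +_) (∑-swap xs ys f)) (sym (∑-+ ys (f x) (λ y → ∑ xs (λ x′ → f x′ y))))

module _ {P : A → Set} (P? : Decidable P) where

  count-∷ : ∀ x xs → count P? (x ∷ xs) ≡ indicator (P? x) + count P? xs
  count-∷ x xs with P? x
  ... | yes _ = refl
  ... | no _  = refl

  count≡∑indicator : ∀ xs → count P? xs ≡ ∑ xs (indicator ∘ P?)
  count≡∑indicator []       = refl
  count≡∑indicator (x ∷ xs) = trans (count-∷ x xs) (cong (indicator (P? x) +_) (count≡∑indicator xs))

  count-++ : ∀ xs ys → count P? (xs ++ ys) ≡ count P? xs + count P? ys
  count-++ xs ys = trans (cong length (filter-++ P? xs ys)) (length-++ (filter P? xs))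

  count-map : ∀ (f : B → A) xs → count P? (map f xs) ≡ count (P? ∘ f) xs
  count-map f []       = refl
  count-map f (x ∷ xs) with P? (f x)
  ... | yes _ = cong suc (count-map f xs)
  ... | no _  = count-map f xs

  count-none : ∀ {xs} → All (∁ P) xs → count P? xs ≡ 0
  count-none ¬ps = cong length (filter-none P? ¬ps)

  count-pos : ∀ {x xs} → x ∈ xs → P x → 0 < count P? xs
  count-pos x∈xs px = nonEmpty (∈-filter⁺ P? x∈xs px)
    where
    nonEmpty : ∀ {y ys} → y ∈ ys → 0 < length ys
    nonEmpty (here _)  = s≤s z≤n
    nonEmpty (there _) = s≤s z≤n

module _ {P Q : A → Set} (P? : Decidable P) (Q? : Decidable Q) where

  count-mono : P ⊆ Q → ∀ xs → count P? xs ≤ count Q? xs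
  count-mono P⊆Q []       = z≤n
  count-mono P⊆Q (x ∷ xs) with P? x | Q? x
  ... | yes _ | yes _  = s≤s (count-mono P⊆Q xs)
  ... | yes p | no ¬q  = ⊥-elim (¬q (P⊆Q p))
  ... | no _  | yes _  = m≤n⇒m≤1+n (count-mono P⊆Q xs)
  ... | no _  | no _   = count-mono P⊆Q xs

  count-cong : P ⊆ Q → Q ⊆ P → ∀ xs → count P? xs ≡ count Q? xs
  count-cong P⊆Q Q⊆P xs = cong length (filter-≐ P? Q? (P⊆Q , Q⊆P) xs)

  count-∪ : ∀ {R : A → Set} (R? : Decidable R) → (∀ {x} → P x → Q x ⊎ R x) →
            ∀ xs → count P? xs ≤ count Q? xs + count R? xs
  count-∪ {R} R? P⊆Q∪R xs = begin
    count P? xs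
      ≡⟨ count≡∑indicator P? xs ⟩
    ∑ xs (indicator ∘ P?)
      ≤⟨ ∑-mono-≤ (All.universal (λ x → pointwise (P? x) (Q? x) (R? x)) xs) ⟩
    ∑ xs (λ x → indicator (Q? x) + indicator (R? x))
      ≡⟨ ∑-+ xs (indicator ∘ Q?) (indicator ∘ R?) ⟩
    ∑ xs (indicator ∘ Q?) + ∑ xs (indicator ∘ R?)
      ≡⟨ sym (cong₂ _+_ (count≡∑indicator Q? xs) (count≡∑indicator R? xs)) ⟩
    count Q? xs + count R? xs
      ∎
    where
    open ≤-Reasoning
    pointwise : ∀ {x} (p : Dec (P x)) (q : Dec (Q x)) (r : Dec (R x)) → indicator p ≤ indicator q + indicator r
    pointwise (no _)  _       _       = z≤n
    pointwise (yes _) (yes _) _       = s≤s z≤n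
    pointwise (yes _) (no _)  (yes _) = ≤-refl
    pointwise (yes p) (no ¬q) (no ¬r) = ⊥-elim ([ ¬q , ¬r ] (P⊆Q∪R p))

count-swap : ∀ {R : A → B → Set} (R? : ∀ x y → Dec (R x y)) (xs : List A) (ys : List B) →
             ∑ xs (λ x → count (R? x) ys) ≡ ∑ ys (λ y → count (λ x → R? x y) xs)
count-swap R? xs ys = begin
  ∑ xs (λ x → count (R? x) ys)
    ≡⟨ ∑-cong (All.universal (λ x → count≡∑indicator (R? x) ys) xs) ⟩
  ∑ xs (λ x → ∑ ys (λ y → indicator (R? x y)))
    ≡⟨ ∑-swap xs ys (λ x y → indicator (R? x y)) ⟩
  ∑ ys (λ y → ∑ xs (λ x → indicator (R? x y)))
    ≡⟨ sym (∑-cong (All.universal (λ y → count≡∑indicator (λ x → R? x y) xs) ys)) ⟩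
  ∑ ys (λ y → count (λ x → R? x y) xs)
    ∎
  where open ≡-Reasoning

count-cartesianProductWith :
  ∀ {C : Set} {P : A → Set} {R : B → Set} {Q : C → Set}
  (P? : Decidable P) (R? : Decidable R) (Q? : Decidable Q) (f : A → B → C) →
  (∀ {a b} → Q (f a b) → P a × R b) → (∀ {a b} → P a → R b → Q (f a b)) →
  ∀ as bs → count Q? (cartesianProductWith f as bs) ≡ count P? as * count R? bs
count-cartesianProductWith P? R? Q? f split join []       bs = refl
count-cartesianProductWith P? R? Q? f split join (a ∷ as) bs = begin
  count Q? (map (f a) bs ++ cartesianProductWith f as bs)
    ≡⟨ count-++ Q? (map (f a) bs) _ ⟩
  count Q? (map (f a) bs) + count Q? (cartesianProductWith f as bs)
    ≡⟨ cong₂ _+_ (trans (count-map Q? (f a) bs) row) (count-cartesianProductWith P? R? Q? f split join as bs) ⟩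
  indicator (P? a) * count R? bs + count P? as * count R? bs
    ≡⟨ sym (*-distribʳ-+ (count R? bs) (indicator (P? a)) (count P? as)) ⟩
  (indicator (P? a) + count P? as) * count R? bs
    ≡⟨ cong (_* count R? bs) (sym (count-∷ P? a as)) ⟩
  count P? (a ∷ as) * count R? bs
    ∎
  where
  open ≡-Reasoning
  row : count (Q? ∘ f a) bs ≡ indicator (P? a) * count R? bs
  row with P? a
  ... | yes pa = trans (count-cong (Q? ∘ f a) R? (proj₂ ∘ split) (join pa) bs) (sym (+-identityʳ _))
  ... | no ¬pa = count-none (Q? ∘ f a) (All.universal (λ _ → ¬pa ∘ proj₁ ∘ split) bs)

∏ : ∀ {d} → (Fin d → ℕ) → ℕ
∏ {zero}  a = 1
∏ {suc d} a = a zero * ∏ (a ∘ suc)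

∏-mono-≤ : ∀ {d} {a b : Fin d → ℕ} → (∀ j → a j ≤ b j) → ∏ a ≤ ∏ b
∏-mono-≤ {zero}  a≤b = ≤-refl
∏-mono-≤ {suc d} a≤b = *-mono-≤ (a≤b zero) (∏-mono-≤ (a≤b ∘ suc))

^≤∏ : ∀ {d c} {a : Fin d → ℕ} → (∀ j → c ≤ a j) → c ^ d ≤ ∏ a
^≤∏ {zero}  c≤a = ≤-refl
^≤∏ {suc d} c≤a = *-mono-≤ (c≤a zero) (^≤∏ (c≤a ∘ suc))

∏≤^ : ∀ {d c} {a : Fin d → ℕ} → (∀ j → a j ≤ c) → ∏ a ≤ c ^ d
∏≤^ {zero}  a≤c = ≤-refl
∏≤^ {suc d} a≤c = *-mono-≤ (a≤c zero) (∏≤^ (a≤c ∘ suc))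

∏-punchIn : ∀ {d} (i : Fin (suc d)) (a : Fin (suc d) → ℕ) → ∏ a ≡ a i * ∏ (a ∘ punchIn i)
∏-punchIn zero              a = refl
∏-punchIn {suc d} (suc i)   a =
  trans (cong (a zero *_) (∏-punchIn i (a ∘ suc))) (x∙yz≈y∙xz (a zero) (a (suc i)) (∏ (a ∘ suc ∘ punchIn i)))

∏+∏+k≤*∏ : ∀ {d} (i : Fin d) (a a′ b : Fin d → ℕ) (c k : ℕ) →
  a i + a′ i + k ≤ c * b i →
  (∀ j → j ≢ i → a j ≤ b j) → (∀ j → j ≢ i → a′ j ≤ b j) → (∀ j → 1 ≤ b j) →
  ∏ a + ∏ a′ + k ≤ c * ∏ b
∏+∏+k≤*∏ {suc d} i a a′ b c k along a≤b a′≤b 1≤b = begin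
  ∏ a + ∏ a′ + k
    ≡⟨ cong₂ (λ x y → x + y + k) (∏-punchIn i a) (∏-punchIn i a′) ⟩
  a i * X + a′ i * X′ + k
    ≤⟨ +-mono-≤ (+-mono-≤ (*-monoʳ-≤ (a i) X≤Y) (*-monoʳ-≤ (a′ i) X′≤Y)) k≤k*Y ⟩
  a i * Y + a′ i * Y + k * Y
    ≡⟨ sym (trans (*-distribʳ-+ Y (a i + a′ i) k) (cong (_+ k * Y) (*-distribʳ-+ Y (a i) (a′ i)))) ⟩
  (a i + a′ i + k) * Y
    ≤⟨ *-monoˡ-≤ Y along ⟩
  c * b i * Y
    ≡⟨ *-assoc c (b i) Y ⟩
  c * (b i * Y)
    ≡⟨ cong (c *_) (sym (∏-punchIn i b)) ⟩
  c * ∏ b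
    ∎
  where
  open ≤-Reasoning
  X X′ Y : ℕ
  X  = ∏ (a ∘ punchIn i)
  X′ = ∏ (a′ ∘ punchIn i)
  Y  = ∏ (b ∘ punchIn i)
  X≤Y : X ≤ Y
  X≤Y = ∏-mono-≤ (λ j → a≤b (punchIn i j) (punchInᵢ≢i i j))
  X′≤Y : X′ ≤ Y
  X′≤Y = ∏-mono-≤ (λ j → a′≤b (punchIn i j) (punchInᵢ≢i i j))
  k≤k*Y : k ≤ k * Y
  k≤k*Y = ≤-trans (≤-reflexive (sym (*-identityʳ k)))
                  (*-monoʳ-≤ k (subst (_≤ Y) (^-zeroˡ d) (^≤∏ (1≤b ∘ punchIn i))))

count-downFrom-mono : ∀ {P : ℕ → Set} (P? : Decidable P) {m m′} → m ≤ m′ →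
                      count P? (downFrom m) ≤ count P? (downFrom m′)
count-downFrom-mono P? {m′ = zero}   z≤n = z≤n
count-downFrom-mono P? {m} {suc m′} m≤1+m′ with m≤n⇒m<n∨m≡n m≤1+m′
... | inj₂ refl    = ≤-refl
... | inj₁ m<1+m′  = ≤-trans (count-downFrom-mono P? (≤-pred m<1+m′))
                             (≤-trans (m≤n+m _ _) (≤-reflexive (sym (count-∷ P? m′ (downFrom m′)))))

count-≟-downFrom≤1 : ∀ p m → count (_≟ p) (downFrom m) ≤ 1
count-≟-downFrom≤1 p zero    = z≤n
count-≟-downFrom≤1 p (suc m) rewrite count-∷ (_≟ p) m (downFrom m) with m ≟ p
... | yes refl = s≤s (≤-reflexive (count-none (_≟ m) (All.tabulate (λ s∈ s≡m → <-irrefl s≡m (∈-downFrom⁻ s∈)))))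
... | no _     = count-≟-downFrom≤1 p m

grid : ∀ {d} → (Fin d → ℕ) → List (Point d)
grid {zero}  m = [] ∷ []
grid {suc d} m = cartesianProductWith _∷_ (downFrom (m zero)) (grid (m ∘ suc))

grid-bounded : ∀ {d} (m : Fin d → ℕ) → All (λ x → ∀ j → lookup x j < m j) (grid m)
grid-bounded {zero}  m = (λ ()) ∷ []
grid-bounded {suc d} m =
  cartesianProductWith⁺ (setoid ℕ) (setoid (Point d)) _∷_ (downFrom (m zero)) (grid (m ∘ suc))
    (λ a∈ x∈ → λ { zero → ∈-downFrom⁻ a∈ ; (suc j) → All.lookup (grid-bounded (m ∘ suc)) x∈ j })

count-grid : ∀ {d} (m : Fin d → ℕ) (P : Fin d → ℕ → Set) (P? : ∀ j → Decidable (P j))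
  (Q? : Decidable (λ (x : Point d) → ∀ j → P j (lookup x j))) →
  count Q? (grid m) ≡ ∏ (λ j → count (P? j) (downFrom (m j)))
count-grid {zero}  m P P? Q? with Q? []
... | yes _  = refl
... | no ¬q  = ⊥-elim (¬q (λ ()))
count-grid {suc d} m P P? Q? =
  trans (count-cartesianProductWith (P? zero) Q′? Q? _∷_ (λ q → q zero , q ∘ suc)
           (λ p q → λ { zero → p ; (suc j) → q j }) (downFrom (m zero)) (grid (m ∘ suc)))
        (cong (count (P? zero) (downFrom (m zero)) *_) (count-grid (m ∘ suc) (P ∘ suc) (P? ∘ suc) Q′?))
  where
  Q′? : Decidable (λ (x : Point d) → ∀ j → P (suc j) (lookup x j))
  Q′? x = all? (λ j → P? (suc j) (lookup x j))

Spans : ℕ → ℕ → Set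
Spans s t = s ≤ t × t ≤ suc s

spans? : ∀ s t → Dec (Spans s t)
spans? s t = s ≤? t ×-dec t ≤? suc s

Spans-refl : ∀ {t} → Spans t t
Spans-refl {t} = ≤-refl , n≤1+n t

Spans-suc : ∀ {t t′} → suc t ≡ t′ → Spans t t′
Spans-suc refl = n≤1+n _ , ≤-refl

Spans⇒≡pred⊎≡ : ∀ {s t} → Spans s t → s ≡ pred t ⊎ s ≡ t
Spans⇒≡pred⊎≡ {s} {zero}  (s≤0 , _) = inj₂ (n≤0⇒n≡0 s≤0)
Spans⇒≡pred⊎≡ {s} {suc t} (s≤1+t , 1+t≤1+s) with m≤n⇒m<n∨m≡n s≤1+t
... | inj₁ s<1+t = inj₁ (≤-antisym (≤-pred s<1+t) (≤-pred 1+t≤1+s))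
... | inj₂ s≡1+t = inj₂ s≡1+t

spanning-corner : ∀ {t m} → t < m → 2 ≤ m → Σ ℕ λ s → s < pred m × Spans s t
spanning-corner {zero}  {suc zero}    _         (s≤s ())
spanning-corner {zero}  {suc (suc m)} _         _ = 0 , s≤s z≤n , z≤n , z≤n
spanning-corner {suc t} {suc m}       (s≤s t<m) _ = t , t<m , n≤1+n t , ≤-refl

count-spanning≤2 : ∀ t m → count (λ s → spans? s t) (downFrom m) ≤ 2
count-spanning≤2 t m =
  ≤-trans (count-∪ (λ s → spans? s t) (_≟ pred t) (_≟ t) Spans⇒≡pred⊎≡ (downFrom m))
          (+-mono-≤ (count-≟-downFrom≤1 (pred t) m) (count-≟-downFrom≤1 t m))

count-spanning-0≤1 : ∀ m → count (λ s → spans? s 0) (downFrom m) ≤ 1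
count-spanning-0≤1 m =
  ≤-trans (count-mono (λ s → spans? s 0) (_≟ 0) (n≤0⇒n≡0 ∘ proj₁) (downFrom m)) (count-≟-downFrom≤1 0 m)

count-spanned≥2 : ∀ t m → suc (suc t) ≤ m → 2 ≤ count (spans? t) (downFrom m)
count-spanned≥2 t m 2+t≤m = ≤-trans two (count-downFrom-mono (spans? t) 2+t≤m)
  where
  two : 2 ≤ count (spans? t) (suc t ∷ t ∷ downFrom t)
  two rewrite filter-accept (spans? t) {suc t} {t ∷ downFrom t} (n≤1+n t , ≤-refl)
            | filter-accept (spans? t) {t} {downFrom t} Spans-refl = s≤s (s≤s z≤n)

_≟ₚ_ : ∀ {d} (u v : Point d) → Dec (u ≡ v)
_≟ₚ_ = Vec.≡-dec _≟_

count-≟ₚ-grid≤1 : ∀ {d} (m : Fin d → ℕ) (u : Point d) → count (_≟ₚ u) (grid m) ≤ 1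
count-≟ₚ-grid≤1 {d} m u = begin
  count (_≟ₚ u) (grid m)
    ≤⟨ count-mono (_≟ₚ u) Q? (λ x≡u j → cong (λ y → lookup y j) x≡u) (grid m) ⟩
  count Q? (grid m)
    ≡⟨ count-grid m (λ j s → s ≡ lookup u j) (λ j → _≟ lookup u j) Q? ⟩
  ∏ (λ j → count (_≟ lookup u j) (downFrom (m j)))
    ≤⟨ ∏≤^ (λ j → count-≟-downFrom≤1 (lookup u j) (m j)) ⟩
  1 ^ d
    ≡⟨ ^-zeroˡ d ⟩
  1
    ∎
  where
  open ≤-Reasoning
  Q? : Decidable (λ (x : Point d) → ∀ j → lookup x j ≡ lookup u j)
  Q? x = all? (λ j → lookup x j ≟ lookup u j)

-- Each v ∈ V lies in exactly one dimer, and since V has no repetitions a dimer uw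
-- collects f only at u and at w.
∑≤∑-endpoints : ∀ {d} (f : Point d → ℕ) (V : List (Point d)) (D : List (Point d × Point d)) →
  (∀ u → count (_≟ₚ u) V ≤ 1) → All (λ v → count (v ∈ₑ?_) D ≡ 1) V →
  ∑ V f ≤ ∑ D (λ e → f (proj₁ e) + f (proj₂ e))
∑≤∑-endpoints f V D unique covered = begin
  ∑ V f                                               ≡⟨ ∑-cong (All.map spread covered) ⟩
  ∑ V (λ v → ∑ D (λ e → f v * indicator (v ∈ₑ? e)))  ≡⟨ ∑-swap V D (λ v e → f v * indicator (v ∈ₑ? e)) ⟩
  ∑ D (λ e → ∑ V (λ v → f v * indicator (v ∈ₑ? e)))  ≤⟨ ∑-mono-≤ (All.universal endpoints D) ⟩
  ∑ D (λ e → f (proj₁ e) + f (proj₂ e))              ∎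
  where
  open ≤-Reasoning
  spread : ∀ {v} → count (v ∈ₑ?_) D ≡ 1 → f v ≡ ∑ D (λ e → f v * indicator (v ∈ₑ? e))
  spread {v} once = begin-equality
    f v                                    ≡⟨ sym (*-identityʳ (f v)) ⟩
    f v * 1                                ≡⟨ cong (f v *_) (sym once) ⟩
    f v * count (v ∈ₑ?_) D                 ≡⟨ cong (f v *_) (count≡∑indicator (v ∈ₑ?_) D) ⟩
    f v * ∑ D (indicator ∘ (v ∈ₑ?_))       ≡⟨ sym (∑-*ˡ D (f v) (indicator ∘ (v ∈ₑ?_))) ⟩
    ∑ D (λ e → f v * indicator (v ∈ₑ? e))  ∎
  at : ∀ u → ∑ V (λ x → f u * indicator (x ≟ₚ u)) ≤ f u
  at u = begin
    ∑ V (λ x → f u * indicator (x ≟ₚ u))   ≡⟨ ∑-*ˡ V (f u) (indicator ∘ (_≟ₚ u)) ⟩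
    f u * ∑ V (indicator ∘ (_≟ₚ u))        ≡⟨ cong (f u *_) (sym (count≡∑indicator (_≟ₚ u) V)) ⟩
    f u * count (_≟ₚ u) V                  ≤⟨ *-monoʳ-≤ (f u) (unique u) ⟩
    f u * 1                                ≡⟨ *-identityʳ (f u) ⟩
    f u                                    ∎
  pointwise : ∀ u w v → f v * indicator (v ∈ₑ? (u , w)) ≤ f u * indicator (v ≟ₚ u) + f w * indicator (v ≟ₚ w)
  pointwise u w v with v ∈ₑ? (u , w)
  ... | no _ = ≤-trans (≤-reflexive (*-zeroʳ (f v))) z≤n
  ... | yes (inj₁ refl) with v ≟ₚ v
  ...   | yes _    = m≤m+n _ _
  ...   | no v≢v   = ⊥-elim (v≢v refl)
  pointwise u w v | yes (inj₂ refl) with v ≟ₚ v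
  ...   | yes _    = m≤n+m _ _
  ...   | no v≢v   = ⊥-elim (v≢v refl)
  endpoints : ∀ e → ∑ V (λ v → f v * indicator (v ∈ₑ? e)) ≤ f (proj₁ e) + f (proj₂ e)
  endpoints (u , w) = begin
    ∑ V (λ v → f v * indicator (v ∈ₑ? (u , w)))
      ≤⟨ ∑-mono-≤ (All.universal (pointwise u w) V) ⟩
    ∑ V (λ v → f u * indicator (v ≟ₚ u) + f w * indicator (v ≟ₚ w))
      ≡⟨ ∑-+ V (λ v → f u * indicator (v ≟ₚ u)) (λ v → f w * indicator (v ≟ₚ w)) ⟩
    ∑ V (λ v → f u * indicator (v ≟ₚ u)) + ∑ V (λ v → f w * indicator (v ≟ₚ w))
      ≤⟨ +-mono-≤ (at u) (at w) ⟩
    f u + f w ∎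

<pred⇒2+≤ : ∀ {t m} → t < pred m → suc (suc t) ≤ m
<pred⇒2+≤ {m = suc m} t<m = s≤s t<m

module Box {d : ℕ} (n : Vec ℕ d) where

  corners vertices : List (Point d)
  corners  = grid (λ j → pred (lookup n j))
  vertices = grid (lookup n)

  corner-fits : ∀ {x} → x ∈ corners → CubeInBox n x
  corner-fits x∈ j = <pred⇒2+≤ (All.lookup (grid-bounded _) x∈ j)

  origin : Point d
  origin = replicate d 0

  cubesAt : Point d → ℕ
  cubesAt v = count (λ x → InCube? x v) corners

  cubesAtDimer : Point d × Point d → ℕ
  cubesAtDimer e = count (λ x → DimerInCube? x e) corners

  positions : Fin d → List ℕ
  positions j = downFrom (pred (lookup n j))

  positionsAt : Point d → Fin d → ℕ
  positionsAt v j = count (λ s → spans? s (lookup v j)) (positions j)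

  positionsAtDimer : Point d → Point d → Fin d → ℕ
  positionsAtDimer u w j = count (λ s → spans? s (lookup u j) ×-dec spans? s (lookup w j)) (positions j)

  cubesAt≡∏ : ∀ v → cubesAt v ≡ ∏ (positionsAt v)
  cubesAt≡∏ v = count-grid _ (λ j s → Spans s (lookup v j)) (λ j s → spans? s (lookup v j)) (λ x → InCube? x v)

  cubesAtDimer≡∏ : ∀ u w → cubesAtDimer (u , w) ≡ ∏ (positionsAtDimer u w)
  cubesAtDimer≡∏ u w =
    trans (count-cong (λ x → DimerInCube? x (u , w)) Q? (λ {x} → split {x}) (λ {x} → join {x}) corners)
          (count-grid _ (λ j s → Spans s (lookup u j) × Spans s (lookup w j))
                        (λ j s → spans? s (lookup u j) ×-dec spans? s (lookup w j)) Q?)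
    where
    Both : Point d → Set
    Both x = ∀ j → Spans (lookup x j) (lookup u j) × Spans (lookup x j) (lookup w j)
    Q? : Decidable Both
    Q? x = all? (λ j → spans? (lookup x j) (lookup u j) ×-dec spans? (lookup x j) (lookup w j))
    split : (λ x → DimerInCube x (u , w)) ⊆ Both
    split (x∋u , x∋w) j = x∋u j , x∋w j
    join : Both ⊆ (λ x → DimerInCube x (u , w))
    join both = proj₁ ∘ both , proj₂ ∘ both

  cube-vertices≥2^d : ∀ {x} → x ∈ corners → 2 ^ d ≤ count (InCube? x) vertices
  cube-vertices≥2^d {x} x∈ = begin
    2 ^ d
      ≤⟨ ^≤∏ (λ j → count-spanned≥2 _ _ (corner-fits x∈ j)) ⟩
    ∏ (λ j → count (spans? (lookup x j)) (downFrom (lookup n j)))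
      ≡⟨ sym (count-grid (lookup n) (λ j → Spans (lookup x j)) (λ j → spans? (lookup x j)) (InCube? x)) ⟩
    count (InCube? x) vertices
      ∎
    where open ≤-Reasoning

  positionsAt-endpoints≤4 : ∀ u w i → positionsAt u i + positionsAt w i + indicator (origin ∈ₑ? (u , w)) ≤ 4
  positionsAt-endpoints≤4 u w i with origin ∈ₑ? (u , w)
  ... | no _ = +-mono-≤ (+-mono-≤ (count-spanning≤2 (lookup u i) m) (count-spanning≤2 (lookup w i) m)) z≤n
    where m = pred (lookup n i)
  ... | yes (inj₁ refl) rewrite Vec.lookup-replicate i 0 =
    +-mono-≤ (+-mono-≤ (count-spanning-0≤1 m) (count-spanning≤2 (lookup w i) m)) ≤-refl
    where m = pred (lookup n i)
  ... | yes (inj₂ refl) rewrite Vec.lookup-replicate i 0 =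
    +-mono-≤ (+-mono-≤ (count-spanning≤2 (lookup u i) m) (count-spanning-0≤1 m)) ≤-refl
    where m = pred (lookup n i)

  module _ (shape : IsShape n) where

    origin-in-box : InBox n origin
    origin-in-box j rewrite Vec.lookup-replicate j 0 = ≤-trans (s≤s z≤n) (proj₁ shape j)

    dimer-bound : ∀ {u w} → IsEdge n (u , w) →
                  cubesAt u + cubesAt w + indicator (origin ∈ₑ? (u , w)) ≤ 4 * cubesAtDimer (u , w)
    dimer-bound {u} {w} (u∈ , w∈ , i , same , step) = begin
      cubesAt u + cubesAt w + k
        ≡⟨ cong₂ (λ p q → p + q + k) (cubesAt≡∏ u) (cubesAt≡∏ w) ⟩
      ∏ (positionsAt u) + ∏ (positionsAt w) + k
        ≤⟨ ∏+∏+k≤*∏ i _ _ _ 4 k along across-u across-w shared ⟩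
      4 * ∏ (positionsAtDimer u w)
        ≡⟨ cong (4 *_) (sym (cubesAtDimer≡∏ u w)) ⟩
      4 * cubesAtDimer (u , w)
        ∎
      where
      open ≤-Reasoning
      k : ℕ
      k = indicator (origin ∈ₑ? (u , w))
      below : ∀ {t t′} → suc t ≡ t′ → t′ < lookup n i → t ∈ positions i
      below refl t′<n = ∈-downFrom⁺ (suc[m]≤n⇒m≤pred[n] t′<n)
      shared-along : (suc (lookup u i) ≡ lookup w i) ⊎ (suc (lookup w i) ≡ lookup u i) →
                     1 ≤ positionsAtDimer u w i
      shared-along (inj₁ 1+u≡w) = count-pos _ (below 1+u≡w (w∈ i)) (Spans-refl , Spans-suc 1+u≡w)
      shared-along (inj₂ 1+w≡u) = count-pos _ (below 1+w≡u (u∈ i)) (Spans-suc 1+w≡u , Spans-refl)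
      shared : ∀ j → 1 ≤ positionsAtDimer u w j
      shared j with j Fin.≟ i
      ... | yes refl = shared-along step
      ... | no j≢i with spanning-corner (u∈ j) (proj₁ shape j)
      ...   | s , s< , spans = count-pos _ (∈-downFrom⁺ s<) (spans , subst (Spans s) (same j j≢i) spans)
      along : positionsAt u i + positionsAt w i + k ≤ 4 * positionsAtDimer u w i
      along = ≤-trans (positionsAt-endpoints≤4 u w i) (*-monoʳ-≤ 4 (shared i))
      across-u : ∀ j → j ≢ i → positionsAt u j ≤ positionsAtDimer u w j
      across-u j j≢i =
        count-mono (λ s → spans? s (lookup u j)) (λ s → spans? s (lookup u j) ×-dec spans? s (lookup w j))
                   (λ sp → sp , subst (Spans _) (same j j≢i) sp) (positions j)
      across-w : ∀ j → j ≢ i → positionsAt w j ≤ positionsAtDimer u w j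
      across-w j j≢i =
        count-mono (λ s → spans? s (lookup w j)) (λ s → spans? s (lookup u j) ×-dec spans? s (lookup w j))
                   (λ sp → subst (Spans _) (sym (same j j≢i)) sp , sp) (positions j)

    cube-vertices<4*cube-dimers : ∀ {D} → IsDimerConfig n D →
      ∑ corners (λ x → count (InCube? x) vertices) < 4 * ∑ corners (λ x → dimersInCube x D)
    cube-vertices<4*cube-dimers {D} (edges , covered) = begin-strict
      ∑ corners (λ x → count (InCube? x) vertices)
        ≡⟨ count-swap InCube? corners vertices ⟩
      ∑ vertices cubesAt
        ≤⟨ ∑≤∑-endpoints cubesAt vertices D (count-≟ₚ-grid≤1 _) (All.map (λ {v} → covered v) (grid-bounded _)) ⟩
      ∑ D ends
        <⟨ m<m+n (∑ D ends) (≤-reflexive (sym (covered origin origin-in-box))) ⟩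
      ∑ D ends + count (origin ∈ₑ?_) D
        ≡⟨ cong (∑ D ends +_) (count≡∑indicator (origin ∈ₑ?_) D) ⟩
      ∑ D ends + ∑ D (indicator ∘ (origin ∈ₑ?_))
        ≡⟨ sym (∑-+ D ends (indicator ∘ (origin ∈ₑ?_))) ⟩
      ∑ D (λ e → ends e + indicator (origin ∈ₑ? e))
        ≤⟨ ∑-mono-≤ bounded ⟩
      ∑ D (λ e → 4 * cubesAtDimer e)
        ≡⟨ ∑-*ˡ D 4 cubesAtDimer ⟩
      4 * ∑ D cubesAtDimer
        ≡⟨ cong (4 *_) (sym (count-swap DimerInCube? corners D)) ⟩
      4 * ∑ corners (λ x → dimersInCube x D)
        ∎
      where
      open ≤-Reasoning
      ends : Point d × Point d → ℕ
      ends e = cubesAt (proj₁ e) + cubesAt (proj₂ e)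
      bounded : All (λ e → ends e + indicator (origin ∈ₑ? e) ≤ 4 * cubesAtDimer e) D
      bounded = All.tabulate (λ { {u , w} e∈ → dimer-bound (edges (u , w) e∈) })

4*2^[d∸2]≡2^d : ∀ {d} → 2 ≤ d → 4 * 2 ^ (d ∸ 2) ≡ 2 ^ d
4*2^[d∸2]≡2^d {suc zero}    (s≤s ())
4*2^[d∸2]≡2^d {suc (suc d)} _ = *-assoc 2 2 (2 ^ d)

theorem1p3 : (d : ℕ) → 2 ≤ d → (n : Vec ℕ d) → IsShape n →
    (D : List (Point d × Point d)) → IsDimerConfig n D →
    Σ (Point d) λ x → CubeInBox n x × (suc (2 ^ (d ∸ 2)) ≤ dimersInCube x D)
theorem1p3 d 2≤d n shape D conf with any? (λ x → 2 ^ (d ∸ 2) <? dimersInCube x D) (Box.corners n)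
... | yes crowded = let x , x∈ , many = find crowded in x , Box.corner-fits n x∈ , many
... | no uncrowded = ⊥-elim (<-irrefl refl (begin-strict
  4 * ∑ corners dimers
    ≡⟨ sym (∑-*ˡ corners 4 dimers) ⟩
  ∑ corners (λ x → 4 * dimers x)
    ≤⟨ ∑-mono-≤ (All.tabulate (λ x∈ → fewer (All.lookup (¬Any⇒All¬ _ uncrowded) x∈) x∈)) ⟩
  ∑ corners (λ x → count (InCube? x) vertices)
    <⟨ cube-vertices<4*cube-dimers shape conf ⟩
  4 * ∑ corners dimers
    ∎))
  where
  open Box n
  open ≤-Reasoning
  dimers : Point d → ℕ
  dimers x = dimersInCube x D
  fewer : ∀ {x} → ¬ 2 ^ (d ∸ 2) < dimers x → x ∈ corners → 4 * dimers x ≤ count (InCube? x) vertices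
  fewer few x∈ = ≤-trans (*-monoʳ-≤ 4 (≮⇒≥ few)) (≤-trans (≤-reflexive (4*2^[d∸2]≡2^d 2≤d)) (cube-vertices≥2^d x∈))
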